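{- Let $k\ge1$, $j\ge1$ and $\hat x\in X_\mathcal{A}^k$. Then $$\sqrt{\tfrac{j+1}{j}}\,\theta_L\,\Xi^*_{j,0}(\hat x)=\sqrt{\tfrac{j+1}{j}}\,\theta_R\,\Xi^*_{j,0}(\hat x)=\Xi^*_{j-1,0}(\hat x).$$
   Context: $\mathcal{A}$ is a finite alphabet with $q$ letters, $V_\mathcal{A}=\mathbb{C}^q$ with standard basis $\{e_a\}$, $V_\mathcal{A}^m$ its $m$-fold tensor power. $f_0=q^{ -1/2}\sum_a e_a$. For $m\ge1$, $\theta_L,\theta_R:V_\mathcal{A}^m\to V_\mathcal{A}^{m-1}$ are linear with $\theta_L(v_1\otimes\cdots\otimes v_m)=\langle f_0,v_1\rangle v_2\otimes\cdots\otimes v_m$, $\theta_R(v_1\otimes\cdots\otimes v_m)=\langle f_0,v_m\rangle v_1\otimes\cdots\otimes v_{m-1}$; adjoints $\theta_L^*(u)=f_0\otimes u$, $\theta_R^*(u)=u\otimes f_0$. $X_\mathcal{A}^k=\ker\theta_L\cap\ker\theta_R\subseteq V_\mathcal{A}^k$. For $j\ge0$, $\Xi^*_{j,0}:V_\mathcal{A}^k\to V_\mathcal{A}^{k+j}$ is $\Xi^*_{j,0}(v)=\frac{1}{\sqrt{j+1}}\sum_{\ell=0}^{j}(\theta_L^*)^{j-\ell}(\theta_R^*)^{\ell}(v)$. -}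

module Defs where

open import Level using (Level)
open import Algebra.Bundles using (CommutativeRing)
open import Data.Nat using (ℕ; zero; suc; _∸_; _≤_) renaming (_+_ to _+ℕ_)
open import Data.Nat.Properties using (+-assoc; m∸n+n≡m)
open import Data.Fin using (Fin; toℕ)
open import Data.Product using (_×_)
open import Data.Fin.Properties using (toℕ≤pred[n])
open import Data.Vec using (Vec; _∷_; _∷ʳ_; init; cast)
open import Relation.Binary.PropositionalEquality using (_≡_; sym; trans; cong)

lenEq : ∀ j ℓ k → ℓ ≤ j → j ∸ ℓ +ℕ (ℓ +ℕ k) ≡ j +ℕ k
lenEq j ℓ k ℓ≤j = trans (sym (+-assoc (j ∸ ℓ) ℓ k)) (cong (_+ℕ k) (m∸n+n≡m ℓ≤j))

module _ {c ℓ : Level} (R : CommutativeRing c ℓ) where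
  open CommutativeRing R using (Carrier; _≈_; _+_; _*_; 0#; 1#)

  ι : ℕ → Carrier
  ι zero    = 0#
  ι (suc n) = 1# + ι n

  IsInvSqrt : (ℕ → Carrier) → Set ℓ
  IsInvSqrt isq = ∀ n → 1 ≤ n → isq n * isq n * ι n ≈ 1#

  ∑ : ∀ {n} → (Fin n → Carrier) → Carrier
  ∑ {zero}  f = 0#
  ∑ {suc n} f = f Fin.zero + ∑ (λ i → f (Fin.suc i))

  -- V_A^m = functions on words of length m over the alphabet Fin q
  -- (coordinates with respect to the basis e_{a1} ⊗ ... ⊗ e_{am})
  V : ℕ → ℕ → Set c
  V q m = Vec (Fin q) m → Carrier

  _≋_ : ∀ {q m} → V q m → V q m → Set ℓ
  u ≋ v = ∀ w → u w ≈ v w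

  module Space (isq : ℕ → Carrier) (q : ℕ) where

    -- each coordinate of f0 equals q^{-1/2}; ⟨f0 , v⟩ = Σ_a q^{-1/2} v_a
    θL : ∀ {m} → V q (suc m) → V q m
    θL v w = isq q * ∑ (λ a → v (a ∷ w))

    θR : ∀ {m} → V q (suc m) → V q m
    θR v w = isq q * ∑ (λ a → v (w ∷ʳ a))

    θL* : ∀ {m} → V q m → V q (suc m)
    θL* u (a ∷ w) = isq q * u w

    θR* : ∀ {m} → V q m → V q (suc m)
    θR* u w = isq q * u (init w)

    θL*^ : ∀ i {m} → V q m → V q (i +ℕ m)
    θL*^ zero    u = u
    θL*^ (suc i) u = θL* (θL*^ i u)

    θR*^ : ∀ i {m} → V q m → V q (i +ℕ m)
    θR*^ zero    u = u
    θR*^ (suc i) u = θR* (θR*^ i u)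

    _+V_ : ∀ {m} → V q m → V q m → V q m
    (u +V v) w = u w + v w

    0V : ∀ {m} → V q m
    0V w = 0#

    _·V_ : ∀ {m} → Carrier → V q m → V q m
    (s ·V v) w = s * v w

    ∑V : ∀ {n m} → (Fin n → V q m) → V q m
    ∑V {zero}  f = 0V
    ∑V {suc n} f = f Fin.zero +V ∑V (λ i → f (Fin.suc i))

    castV : ∀ {m n} → m ≡ n → V q m → V q n
    castV eq v w = v (cast (sym eq) w)

    term : ∀ j {k} → Fin (suc j) → V q k → V q (j +ℕ k)
    term j {k} i v =
      castV (lenEq j (toℕ i) k (toℕ≤pred[n] i)) (θL*^ (j ∸ toℕ i) (θR*^ (toℕ i) v))

    Ξ* : ∀ j {k} → V q k → V q (j +ℕ k)
    Ξ* j v = isq (suc j) ·V ∑V (λ i → term j i v)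

    InX : ∀ {k} → V q (suc k) → Set ℓ
    InX x = (θL x ≋ 0V) × (θR x ≋ 0V)

    -- sqrt((j+1)/j) = (j+1) · (j+1)^{-1/2} · j^{-1/2}
    sqrtRatio : ℕ → Carrier
    sqrtRatio j = ι (suc j) * isq (suc j) * isq j

-- Write S_j x = Σ_{ℓ=0}^{j} (θ_L^*)^{j-ℓ} (θ_R^*)^ℓ x, so that Ξ^*_{j,0} x = (j+1)^{-1/2} S_j x.
-- Since f₀ is a unit vector, θ_L θ_L^* = id = θ_R θ_R^*; moreover θ_L commutes with θ_R^* and θ_R
-- with θ_L^*. Applying θ_L to S_{j+1} x therefore turns every summand with ℓ ≤ j into the
-- corresponding summand of S_j x, while the remaining summand (θ_R^*)^{j+1} x is killed because
-- θ_L x = 0; symmetrically for θ_R, where the summand with ℓ = 0 dies. Hence θ S_{j+1} x = S_j x for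
-- θ ∈ {θ_L, θ_R}, and the normalising constants combine to √((j+1)/j).

module Submission where

open import Defs
open import Level using (Level)
open import Algebra.Bundles using (CommutativeRing)
open import Data.Nat using (ℕ; suc; _≤_)
open import Data.Product using (_×_; _,_)
open import Data.Nat using (zero; _∸_; z≤n; s≤s) renaming (_+_ to _+ℕ_)
open import Data.Nat.Properties using (+-∸-assoc; n∸n≡0; +-suc; suc-injective; m+1+n≢0)
open import Data.Fin using (Fin; toℕ; inject₁; fromℕ)
open import Data.Fin.Properties using (toℕ-inject₁; toℕ-fromℕ; toℕ≤pred[n])
open import Data.Vec using (Vec; _∷_; _∷ʳ_; init; cast)
open import Data.Vec.Properties using (cast-∷ʳ; init-∷ʳ)
open import Data.Vec.Relation.Binary.Equality.Cast using (cast-is-id)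
open import Data.Empty using (⊥-elim)
open import Function using (_∘_)
import Algebra.Properties.Semiring.Sum as SemiringSum
import Algebra.Properties.CommutativeSemigroup as CommutativeSemigroupProperties
import Relation.Binary.PropositionalEquality as ≡
open ≡ using (_≡_)
import Relation.Binary.Reasoning.Setoid as SetoidReasoning

module _ {c ℓ : Level} (R : CommutativeRing c ℓ) where
  open CommutativeRing R
  private module Sum = SemiringSum semiring
  open Sum using (sum)
  open CommutativeSemigroupProperties *-commutativeSemigroup using (x∙yz≈y∙xz; xy∙z≈xz∙y; xy∙z≈zy∙x)
  open SetoidReasoning setoid

  infix 4 _≋ᵣ_
  _≋ᵣ_ : ∀ {q m} → V R q m → V R q m → Set ℓ
  _≋ᵣ_ = _≋_ R

  ∑≡sum : ∀ {n} (f : Fin n → Carrier) → ∑ R f ≡ sum f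
  ∑≡sum {zero}  f = ≡.refl
  ∑≡sum {suc n} f = ≡.cong (f Fin.zero +_) (∑≡sum (f ∘ Fin.suc))

  ∑-cong : ∀ {n} {f g : Fin n → Carrier} → (∀ i → f i ≈ g i) → ∑ R f ≈ ∑ R g
  ∑-cong {f = f} {g} f≈g rewrite ∑≡sum f | ∑≡sum g = Sum.sum-cong-≋ f≈g

  *-distribˡ-∑ : ∀ {n} x (f : Fin n → Carrier) → x * ∑ R f ≈ ∑ R (λ i → x * f i)
  *-distribˡ-∑ x f rewrite ∑≡sum f | ∑≡sum (λ i → x * f i) = Sum.*-distribˡ-sum x f

  ∑-init-last : ∀ {n} (f : Fin (suc n) → Carrier) → ∑ R f ≈ ∑ R (f ∘ inject₁) + f (fromℕ n)
  ∑-init-last f rewrite ∑≡sum f | ∑≡sum (f ∘ inject₁) = Sum.sum-init-last f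

  ∑-comm : ∀ {m n} (f : Fin m → Fin n → Carrier) →
           ∑ R (λ i → ∑ R (λ j → f i j)) ≈ ∑ R (λ j → ∑ R (λ i → f i j))
  ∑-comm f = begin
    ∑ R (λ i → ∑ R (f i))                 ≡⟨ ∑≡sum (λ i → ∑ R (f i)) ⟩
    sum (λ i → ∑ R (f i))                 ≡⟨ Sum.sum-cong-≗ (λ i → ∑≡sum (f i)) ⟩
    sum (λ i → sum (f i))                 ≈⟨ Sum.∑-comm f ⟩
    sum (λ j → sum (λ i → f i j))         ≡⟨ Sum.sum-cong-≗ (λ j → ∑≡sum (λ i → f i j)) ⟨
    sum (λ j → ∑ R (λ i → f i j))         ≡⟨ ∑≡sum (λ j → ∑ R (λ i → f i j)) ⟨
    ∑ R (λ j → ∑ R (λ i → f i j))         ∎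

  ∑-const : ∀ n (y : Carrier) → ∑ R {n} (λ _ → y) ≈ ι R n * y
  ∑-const zero    y = sym (zeroˡ y)
  ∑-const (suc n) y = begin
    y + ∑ R {n} (λ _ → y) ≈⟨ +-cong (sym (*-identityˡ y)) (∑-const n y) ⟩
    1# * y + ι R n * y    ≈⟨ distribʳ y 1# (ι R n) ⟨
    ι R (suc n) * y       ∎

  module _ (isq : ℕ → Carrier) (q : ℕ) where
    open Space R isq q

    ∑V-apply : ∀ {n m} (f : Fin n → V R q m) w → ∑V f w ≡ ∑ R (λ i → f i w)
    ∑V-apply {zero}  f w = ≡.refl
    ∑V-apply {suc n} f w = ≡.cong (f Fin.zero w +_) (∑V-apply (f ∘ Fin.suc) w)

    ∑V-cong : ∀ {n m} {f g : Fin n → V R q m} → (∀ i → f i ≋ᵣ g i) → ∑V f ≋ᵣ ∑V g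
    ∑V-cong {f = f} {g} f≋g w rewrite ∑V-apply f w | ∑V-apply g w = ∑-cong (λ i → f≋g i w)

    ∑V-init-last : ∀ {n m} (f : Fin (suc n) → V R q m) → ∑V f ≋ᵣ ∑V (f ∘ inject₁) +V f (fromℕ n)
    ∑V-init-last f w rewrite ∑V-apply f w | ∑V-apply (f ∘ inject₁) w = ∑-init-last (λ i → f i w)

    castV-id : ∀ {m} (e : m ≡ m) (u : V R q m) → castV e u ≋ᵣ u
    castV-id e u w = reflexive (≡.cong u (cast-is-id (≡.sym e) w))

    castV-cong : ∀ {m n} (e : m ≡ n) {u v : V R q m} → u ≋ᵣ v → castV e u ≋ᵣ castV e v
    castV-cong e u≋v w = u≋v (cast (≡.sym e) w)

    -- Only the lengths matter: cast ignores its (irrelevant) proof.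
    castV-reindex : ∀ {len : ℕ → ℕ → ℕ} (F : ∀ a b → V R q (len a b)) {a a′ b b′ n} →
                    a ≡ a′ → b ≡ b′ → (e : len a b ≡ n) (e′ : len a′ b′ ≡ n) →
                    castV e (F a b) ≋ᵣ castV e′ (F a′ b′)
    castV-reindex F ≡.refl ≡.refl e e′ w = refl

    term-inject₁ : ∀ j {k} (i : Fin (suc j)) (v : V R q k) → term (suc j) (inject₁ i) v ≋ᵣ θL* (term j i v)
    term-inject₁ j {k} i v (a ∷ w) =
      castV-reindex (λ a b → θL*^ a (θR*^ b v))
        (≡.trans (≡.cong (suc j ∸_) (toℕ-inject₁ i)) (+-∸-assoc 1 (toℕ≤pred[n] i)))
        (toℕ-inject₁ i)
        (lenEq (suc j) (toℕ (inject₁ i)) k (toℕ≤pred[n] (inject₁ i)))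
        (≡.cong suc (lenEq j (toℕ i) k (toℕ≤pred[n] i)))
        (a ∷ w)

    term-last : ∀ j {k} (v : V R q k) → term j (fromℕ j) v ≋ᵣ θR*^ j v
    term-last j {k} v w = trans
      (castV-reindex (λ a b → θL*^ a (θR*^ b v))
        (≡.trans (≡.cong (j ∸_) (toℕ-fromℕ j)) (n∸n≡0 j)) (toℕ-fromℕ j)
        (lenEq j (toℕ (fromℕ j)) k (toℕ≤pred[n] (fromℕ j))) ≡.refl w)
      (castV-id ≡.refl (θR*^ j v) w)

    θL*^-cong : ∀ a {m} {u v : V R q m} → u ≋ᵣ v → θL*^ a u ≋ᵣ θL*^ a v
    θL*^-cong zero    u≋v w       = u≋v w
    θL*^-cong (suc a) u≋v (b ∷ w) = *-congˡ (θL*^-cong a u≋v w)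

    θL*^-0V : ∀ a {m} → θL*^ a (0V {m}) ≋ᵣ 0V
    θL*^-0V zero    w       = refl
    θL*^-0V (suc a) (b ∷ w) = trans (*-congˡ (θL*^-0V a w)) (zeroʳ _)

    -- θ_L and θ_R are both instances of this contraction, for the two ways of inserting a letter.
    contract : ∀ {m n} → (Fin q → Vec (Fin q) m → Vec (Fin q) n) → V R q n → V R q m
    contract ins v w = isq q * ∑ R (λ a → v (ins a w))

    contract-cong : ∀ {m n} ins {u v : V R q n} → u ≋ᵣ v → contract {m} ins u ≋ᵣ contract ins v
    contract-cong ins u≋v w = *-congˡ (∑-cong (λ a → u≋v (ins a w)))

    contract-·V : ∀ {m n} ins t (v : V R q n) → contract {m} ins (t ·V v) ≋ᵣ t ·V contract ins v
    contract-·V ins t v w = begin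
      isq q * ∑ R (λ a → t * v (ins a w))   ≈⟨ *-congˡ (*-distribˡ-∑ t (λ a → v (ins a w))) ⟨
      isq q * (t * ∑ R (λ a → v (ins a w))) ≈⟨ x∙yz≈y∙xz _ _ _ ⟩
      t * (isq q * ∑ R (λ a → v (ins a w))) ∎

    contract-∑V : ∀ {m n k} ins (f : Fin k → V R q n) → contract {m} ins (∑V f) ≋ᵣ ∑V (contract ins ∘ f)
    contract-∑V ins f w = begin
      isq q * ∑ R (λ a → ∑V f (ins a w))                ≈⟨ *-congˡ (∑-cong (λ a → reflexive (∑V-apply f (ins a w)))) ⟩
      isq q * ∑ R (λ a → ∑ R (λ i → f i (ins a w)))     ≈⟨ *-congˡ (∑-comm (λ a i → f i (ins a w))) ⟩
      isq q * ∑ R (λ i → ∑ R (λ a → f i (ins a w)))     ≈⟨ *-distribˡ-∑ (isq q) (λ i → ∑ R (λ a → f i (ins a w))) ⟩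
      ∑ R (λ i → contract ins (f i) w)                  ≡⟨ ∑V-apply (contract ins ∘ f) w ⟨
      ∑V (contract ins ∘ f) w                           ∎

    contract-cancel : isq q * isq q * ι R q ≈ 1# →
                      ∀ {m n} ins (v : V R q n) (u : V R q m) →
                      (∀ a w → v (ins a w) ≈ isq q * u w) → contract ins v ≋ᵣ u
    contract-cancel unit ins v u v≈u w = begin
      isq q * ∑ R (λ a → v (ins a w))      ≈⟨ *-congˡ (∑-cong (λ a → v≈u a w)) ⟩
      s * ∑ R {q} (λ _ → s * u w)          ≈⟨ *-congˡ (∑-const q _) ⟩
      s * (ι R q * (s * u w))              ≈⟨ *-congˡ (x∙yz≈y∙xz _ _ _) ⟩
      s * (s * (ι R q * u w))              ≈⟨ *-assoc _ _ _ ⟨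
      s * s * (ι R q * u w)                ≈⟨ *-assoc _ _ _ ⟨
      s * s * ι R q * u w                  ≈⟨ *-congʳ unit ⟩
      1# * u w                             ≈⟨ *-identityˡ _ ⟩
      u w                                  ∎
      where s = isq q

    θL-θL* : isq q * isq q * ι R q ≈ 1# → ∀ {m} (u : V R q m) → θL (θL* u) ≋ᵣ u
    θL-θL* unit u = contract-cancel unit _∷_ (θL* u) u (λ a w → refl)

    θR-θR* : isq q * isq q * ι R q ≈ 1# → ∀ {m} (u : V R q m) → θR (θR* u) ≋ᵣ u
    θR-θR* unit u = contract-cancel unit (λ a w → w ∷ʳ a) (θR* u) u
                      (λ a w → *-congˡ (reflexive (≡.cong u (init-∷ʳ a w))))

    θL-θR*-vanish : ∀ {m} (v : V R q (suc m)) → θL v ≋ᵣ 0V → θL (θR* v) ≋ᵣ 0V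
    θL-θR*-vanish v θLv≋0 w =
      trans (contract-·V _∷_ (isq q) (v ∘ init) w) (trans (*-congˡ (θLv≋0 (init w))) (zeroʳ _))

    θL-θR*^-vanish : ∀ b {m} (v : V R q (suc m)) → θL v ≋ᵣ 0V → θL (θR*^ (suc b) v) ≋ᵣ 0V
    θL-θR*^-vanish zero    v θLv≋0 = θL-θR*-vanish v θLv≋0
    θL-θR*^-vanish (suc b) v θLv≋0 = θL-θR*-vanish (θR*^ (suc b) v) (θL-θR*^-vanish b v θLv≋0)

    -- The casts are needed because a +ℕ suc p is not definitionally a successor.
    θR-castV-θL*^ : ∀ a {p n} (v : V R q (suc p)) (e : a +ℕ suc p ≡ suc n) (e′ : a +ℕ p ≡ n) →
                    θR (castV e (θL*^ a v)) ≋ᵣ castV e′ (θL*^ a (θR v))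
    θR-castV-θL*^ zero    v e e′ w = *-congˡ (∑-cong (λ a → reflexive (≡.cong v (cast-∷ʳ _ a w))))
    θR-castV-θL*^ (suc a) {n = zero}  v e e′ w = ⊥-elim (m+1+n≢0 a (suc-injective e))
    θR-castV-θL*^ (suc a) {n = suc n} v e e′ (b ∷ w) = trans
      (contract-·V (λ c w → w ∷ʳ c) (isq q) (castV (suc-injective e) (θL*^ a v)) w)
      (*-congˡ (θR-castV-θL*^ a v (suc-injective e) (suc-injective e′) w))

    module _ (unit : isq q * isq q * ι R q ≈ 1#) {k} {x : V R q (suc k)} where

      θL-∑term : θL x ≋ᵣ 0V → ∀ j → θL (∑V (λ i → term (suc j) i x)) ≋ᵣ ∑V (λ i → term j i x)
      θL-∑term θLx≋0 j w = begin
        θL (∑V f) w                                               ≈⟨ contract-∑V _∷_ f w ⟩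
        ∑V (θL ∘ f) w                                             ≈⟨ ∑V-init-last (θL ∘ f) w ⟩
        ∑V (θL ∘ f ∘ inject₁) w + θL (f (fromℕ (suc j))) w        ≈⟨ +-cong (∑V-cong θL-inject₁ w) θL-last ⟩
        ∑V (λ i → term j i x) w + 0#                              ≈⟨ +-identityʳ _ ⟩
        ∑V (λ i → term j i x) w                                   ∎
        where
        f = λ i → term (suc j) i x
        θL-inject₁ : ∀ i → θL (f (inject₁ i)) ≋ᵣ term j i x
        θL-inject₁ i w = trans (contract-cong _∷_ (term-inject₁ j i x) w) (θL-θL* unit (term j i x) w)
        θL-last : θL (f (fromℕ (suc j))) w ≈ 0#
        θL-last = trans (contract-cong _∷_ (term-last (suc j) x) w) (θL-θR*^-vanish j x θLx≋0 w)

      θR-∑term : θR x ≋ᵣ 0V → ∀ j → θR (∑V (λ i → term (suc j) i x)) ≋ᵣ ∑V (λ i → term j i x)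
      θR-∑term θRx≋0 j w = begin
        θR (∑V f) w                                               ≈⟨ contract-∑V (λ a w → w ∷ʳ a) f w ⟩
        θR (f Fin.zero) w + ∑V (θR ∘ f ∘ Fin.suc) w               ≈⟨ +-cong θR-first (∑V-cong θR-suc w) ⟩
        0# + ∑V (λ i → term j i x) w                              ≈⟨ +-identityˡ _ ⟩
        ∑V (λ i → term j i x) w                                   ∎
        where
        f = λ i → term (suc j) i x
        θL*^θRx≋0 : θL*^ (suc j) (θR x) ≋ᵣ 0V
        θL*^θRx≋0 w = trans (θL*^-cong (suc j) θRx≋0 w) (θL*^-0V (suc j) w)
        θR-first : θR (f Fin.zero) w ≈ 0#
        θR-first = trans (θR-castV-θL*^ (suc j) x ≡.refl (≡.sym (+-suc j k)) w)
                         (castV-cong (≡.sym (+-suc j k)) θL*^θRx≋0 w)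
        θR-suc : ∀ i → θR (f (Fin.suc i)) ≋ᵣ term j i x
        θR-suc i w = trans (θR-castV-θL*^ (j ∸ toℕ i) (θR* (θR*^ (toℕ i) x)) e₁ e w)
                           (castV-cong e (θL*^-cong (j ∸ toℕ i) (θR-θR* unit (θR*^ (toℕ i) x))) w)
          where e  = lenEq j (toℕ i) (suc k) (toℕ≤pred[n] i)
                e₁ = lenEq (suc j) (suc (toℕ i)) (suc k) (toℕ≤pred[n] (Fin.suc i))

    sqrtRatio-*-isq : IsInvSqrt R isq → ∀ n → sqrtRatio n * isq (suc n) ≈ isq n
    sqrtRatio-*-isq H n = begin
      ι R (suc n) * b * isq n * b     ≈⟨ xy∙z≈xz∙y _ _ _ ⟩
      ι R (suc n) * b * b * isq n     ≈⟨ *-congʳ (xy∙z≈zy∙x _ _ _) ⟩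
      b * b * ι R (suc n) * isq n     ≈⟨ *-congʳ (H (suc n) (s≤s z≤n)) ⟩
      1# * isq n                      ≈⟨ *-identityˡ _ ⟩
      isq n                           ∎
      where b = isq (suc n)

    sqrtRatio-contract-Ξ* : IsInvSqrt R isq → ∀ j {k} (ins : Fin q → Vec (Fin q) (j +ℕ k) → Vec (Fin q) (suc j +ℕ k))
                            (v : V R q k) →
                            contract ins (∑V (λ i → term (suc j) i v)) ≋ᵣ ∑V (λ i → term j i v) →
                            sqrtRatio (suc j) ·V contract ins (Ξ* (suc j) v) ≋ᵣ Ξ* j v
    sqrtRatio-contract-Ξ* H j ins v θS≋S w = begin
      sqrtRatio (suc j) * contract ins (isq (suc (suc j)) ·V S) w  ≈⟨ *-congˡ (contract-·V ins _ S w) ⟩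
      sqrtRatio (suc j) * (isq (suc (suc j)) * contract ins S w)   ≈⟨ *-assoc _ _ _ ⟨
      sqrtRatio (suc j) * isq (suc (suc j)) * contract ins S w     ≈⟨ *-cong (sqrtRatio-*-isq H (suc j)) (θS≋S w) ⟩
      isq (suc j) * ∑V (λ i → term j i v) w                        ∎
      where S = ∑V (λ i → term (suc j) i v)

mainTheorem9 : {c ℓ : Level} (R : CommutativeRing c ℓ)
    (isq : ℕ → CommutativeRing.Carrier R) → IsInvSqrt R isq →
    (q : ℕ) → 1 ≤ q →
    (k j : ℕ) (x : V R q (suc k)) → Space.InX R isq q x →
    _≋_ R (Space._·V_ R isq q (Space.sqrtRatio R isq q (suc j)) (Space.θL R isq q (Space.Ξ* R isq q (suc j) x)))
    (Space.Ξ* R isq q j x)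
    × _≋_ R (Space._·V_ R isq q (Space.sqrtRatio R isq q (suc j)) (Space.θR R isq q (Space.Ξ* R isq q (suc j) x)))
    (Space.Ξ* R isq q j x)
mainTheorem9 R isq H q q≥1 k j x (θLx≋0 , θRx≋0) =
  sqrtRatio-contract-Ξ* R isq q H j _∷_ x (θL-∑term R isq q (H q q≥1) θLx≋0 j) ,
  sqrtRatio-contract-Ξ* R isq q H j (λ a w → w ∷ʳ a) x (θR-∑term R isq q (H q q≥1) θRx≋0 j)
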